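{- Let $\mathcal{K}=(D,X,H,f)$ be a configuration with $D$ connected, let $v\in V(D)$ be a vertex that is not a separating vertex of $D$ (so $D-v$ is connected), and let $x_v\in X_v$ with $f(x_v)\ne(0,0)$. Let $\mathcal{K}'=(D-v,X',H',f')$ where $X'_u=X_u$ for $u\ne v$, $H'=H-X_v$, and $f'^+(x)=\max\{0,f^+(x)-a_H(x,x_v)\}$, $f'^-(x)=\max\{0,f^-(x)-a_H(x_v,x)\}$ for $x\in V(H')$. Then (a) if $\mathcal{K}$ is degree-feasible, so is $\mathcal{K}'$; and (b) if $\mathcal{K}$ is uncolorable, so is $\mathcal{K}'$.
   Context: Digraphs are finite, without loops and parallel arcs (digons allowed); $d_D(v)=(d^+_D(v),d^-_D(v))$; pairs in $\mathbb{N}_0^2$ compared and added coordinatewise; $a_H(x,y)=1$ if $xy\in A(H)$ and $0$ otherwise. Connected refers to the underlying graph; a separating vertex of a connected $D$ is $v$ with $D-v$ having at least two components. Cover of $D$: pair $(X,H)$, $H$ disjoint from $D$, $X_v\subseteq V(H)$ pairwise disjoint with union $V(H)$, each independent, arcs from $X_u$ to $X_v$ ($u\ne v$) a matching if $uv\in A(D)$, none otherwise. Transversal: $|T\cap X_v|=1$ for all $v$. For $f:V(H)\to\mathbb{N}_0^2$, $f=(f^+,f^-)$, $f(Y)=\sum_{y\in Y}f(y)$; $H$ is strictly $f$-degenerate if every nonempty subdigraph $H''$ of $H$ has a vertex $x$ with $d^+_{H''}(x)<f^+(x)$ or $d^-_{H''}(x)<f^-(x)$. A configuration $(D,X,H,f)$: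 $(X,H)$ a cover of $D$, $f:V(H)\to\mathbb{N}_0^2$; degree-feasible if $f(X_v)\ge d_D(v)$ for all $v$; colorable if some transversal $T$ has $H[T]$ strictly $f$-degenerate; uncolorable otherwise. -}

module Defs where

open import Data.Nat using (ℕ; zero; suc; _+_; _≤_; _<_; _∸_)
open import Data.Fin using (Fin; _≟_)
import Data.Fin as F
open import Data.Bool using (Bool; true; false; _∧_; not; if_then_else_)
open import Data.Product using (Σ; ∃; _×_; _,_; proj₁; proj₂)
open import Data.Sum using (_⊎_)
open import Data.Empty using (⊥)
open import Relation.Nullary using (¬_)
open import Relation.Nullary.Decidable using (⌊_⌋)
open import Relation.Binary.PropositionalEquality using (_≡_; _≢_)

count : ∀ {k} → (Fin k → Bool) → ℕ
count {zero}  P = 0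
count {suc k} P = (if P F.zero then 1 else 0) + count (λ i → P (F.suc i))

sumWhere : ∀ {k} → (Fin k → Bool) → (Fin k → ℕ) → ℕ
sumWhere {zero}  P g = 0
sumWhere {suc k} P g =
  (if P F.zero then g F.zero else 0) + sumWhere (λ i → P (F.suc i)) (λ i → g (F.suc i))

ℕ² : Set
ℕ² = ℕ × ℕ

_≤²_ : ℕ² → ℕ² → Set
(a , b) ≤² (c , d) = (a ≤ c) × (b ≤ d)

-- Digraphs: a finite digraph is given on the ambient set Fin n by its
-- vertex set V ⊆ Fin n and its arc relation A (a relation, hence no
-- parallel arcs; digons allowed).

record Digraph (n : ℕ) : Set where
  field
    V : Fin n → Bool
    A : Fin n → Fin n → Bool
open Digraph public

record IsDigraph {n} (D : Digraph n) : Set where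
  field
    loopless : ∀ x → A D x x ≡ false
    arc-ends : ∀ x y → A D x y ≡ true → (V D x ≡ true) × (V D y ≡ true)

outdeg : ∀ {n} → Digraph n → Fin n → ℕ
outdeg D x = count (λ y → A D x y)

indeg : ∀ {n} → Digraph n → Fin n → ℕ
indeg D x = count (λ y → A D y x)

deg : ∀ {n} → Digraph n → Fin n → ℕ²
deg D x = (outdeg D x , indeg D x)

a : ∀ {n} → Digraph n → Fin n → Fin n → ℕ
a H x y = if A H x y then 1 else 0

deleteSet : ∀ {n} → Digraph n → (Fin n → Bool) → Digraph n
deleteSet D S = record
  { V = λ x → V D x ∧ not (S x)
  ; A = λ x y → A D x y ∧ (not (S x) ∧ not (S y)) }

deleteVertex : ∀ {n} → Digraph n → Fin n → Digraph n
deleteVertex D v = deleteSet D (λ u → ⌊ u ≟ v ⌋)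

induced : ∀ {n} → Digraph n → (Fin n → Bool) → Digraph n
induced D T = record
  { V = λ x → V D x ∧ T x
  ; A = λ x y → A D x y ∧ (T x ∧ T y) }

record IsSubdigraph {n} (G D : Digraph n) : Set where
  field
    G-digraph : IsDigraph G
    V-sub : ∀ x → V G x ≡ true → V D x ≡ true
    A-sub : ∀ x y → A G x y ≡ true → A D x y ≡ true

data Reachable {n} (D : Digraph n) : Fin n → Fin n → Set where
  here  : ∀ {u} → V D u ≡ true → Reachable D u u
  fwd   : ∀ {u w z} → A D u w ≡ true → Reachable D w z → Reachable D u z
  bwd   : ∀ {u w z} → A D w u ≡ true → Reachable D w z → Reachable D u z

Connected : ∀ {n} → Digraph n → Set
Connected D = (∃ λ u → V D u ≡ true) ×
  (∀ u w → V D u ≡ true → V D w ≡ true → Reachable D u w)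

IsSeparating : ∀ {n} → Digraph n → Fin n → Set
IsSeparating D v = Σ _ λ u → Σ _ λ w →
  (V (deleteVertex D v) u ≡ true) × (V (deleteVertex D v) w ≡ true) ×
  ¬ Reachable (deleteVertex D v) u w

-- Covers. X_v = { x ∈ V(H) | p x = v } for a map p : Fin m → Fin n.

inX : ∀ {n m} → Digraph m → (Fin m → Fin n) → Fin n → Fin m → Bool
inX H p v x = V H x ∧ ⌊ p x ≟ v ⌋

record IsCover {n m} (D : Digraph n) (H : Digraph m) (p : Fin m → Fin n) : Set where
  field
    p-into : ∀ x → V H x ≡ true → V D (p x) ≡ true
    -- each X_v is independent
    indep : ∀ x y → A H x y ≡ true → p x ≢ p y
    along : ∀ x y → A H x y ≡ true → A D (p x) (p y) ≡ true
    -- arcs from X_u to X_v form a matching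
    match-out : ∀ x y y' → A H x y ≡ true → A H x y' ≡ true → p y ≡ p y' → y ≡ y'
    match-in  : ∀ x x' y → A H x y ≡ true → A H x' y ≡ true → p x ≡ p x' → x ≡ x'

fX : ∀ {n m} → Digraph m → (Fin m → Fin n) → (Fin m → ℕ²) → Fin n → ℕ²
fX H p f v = (sumWhere (inX H p v) (λ x → proj₁ (f x)) ,
              sumWhere (inX H p v) (λ x → proj₂ (f x)))

DegreeFeasible : ∀ {n m} → Digraph n → Digraph m → (Fin m → Fin n) → (Fin m → ℕ²) → Set
DegreeFeasible D H p f = ∀ v → V D v ≡ true → deg D v ≤² fX H p f v

Transversal : ∀ {n m} → Digraph n → Digraph m → (Fin m → Fin n) → (Fin m → Bool) → Set
Transversal D H p T =
  (∀ x → T x ≡ true → V H x ≡ true) ×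
  (∀ v → V D v ≡ true → count (λ x → T x ∧ inX H p v x) ≡ 1)

StrictlyDegenerate : ∀ {m} → Digraph m → (Fin m → ℕ²) → Set
StrictlyDegenerate G f = ∀ (G'' : Digraph _) → IsSubdigraph G'' G →
  (∃ λ x → V G'' x ≡ true) →
  ∃ λ x → (V G'' x ≡ true) × ((outdeg G'' x < proj₁ (f x)) ⊎ (indeg G'' x < proj₂ (f x)))

Colorable : ∀ {n m} → Digraph n → Digraph m → (Fin m → Fin n) → (Fin m → ℕ²) → Set
Colorable D H p f = Σ (Fin _ → Bool) λ T → Transversal D H p T × StrictlyDegenerate (induced H T) f

Uncolorable : ∀ {n m} → Digraph n → Digraph m → (Fin m → Fin n) → (Fin m → ℕ²) → Set
Uncolorable D H p f = ¬ Colorable D H p f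

reduceF : ∀ {m} → Digraph m → (Fin m → ℕ²) → Fin m → Fin m → ℕ²
reduceF H f xv x = (proj₁ (f x) ∸ a H x xv , proj₂ (f x) ∸ a H xv x)

{-# OPTIONS --safe #-}
-- Since the arcs of H between two fibres form a matching, each fibre X_u (u ≠ v) has at most
-- one arc into x_v and at most one arc out of x_v, and only if D has the corresponding arc
-- between u and v.  Hence passing from f to f' lowers f(X_u) by at most what deleting v
-- lowers d_D(u), and degree-feasibility survives.  For (b), a good transversal T of H - X_v
-- extends to T ∪ {x_v}: in a nonempty subdigraph G of H[T ∪ {x_v}], either G - x_v contains
-- a vertex y that is deficient for f', and the at most one arc between y and x_v in each
-- direction is exactly what f' subtracted from f, or G consists of x_v alone, which is
-- deficient since f(x_v) ≠ (0,0).
module Submission where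

open import Defs
open import Data.Bool using (Bool; true; false; _∧_; _∨_; not; if_then_else_)
import Data.Bool as Bool
open import Data.Bool.Properties using (∧-identityʳ; ∧-zeroʳ; ∨-identityʳ; ∨-zeroʳ; ¬-not; not-¬)
open import Data.Empty using (⊥-elim)
open import Data.Fin using (Fin; zero; suc; _≟_)
open import Data.Fin.Properties using (suc-injective; any?)
open import Data.Nat using (ℕ; zero; suc; _+_; _∸_; _≤_; _<_; z≤n; s≤s)
open import Data.Nat.Properties
  using (+-commutativeSemigroup; ≤-refl; ≤-reflexive; ≤-trans; ≤-<-trans; +-mono-≤; +-monoˡ-≤;
         +-cancelˡ-≤; ∸-monoʳ-≤; m≤n+m∸n; +-identityʳ; +-suc)
open import Algebra.Properties.CommutativeSemigroup +-commutativeSemigroup using (interchange)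
open import Data.Product using (_×_; _,_; proj₁; proj₂)
open import Data.Sum using (_⊎_; inj₁; inj₂)
open import Function using (_∘_)
open import Relation.Nullary using (¬_; yes; no)
open import Relation.Nullary.Decidable using (⌊_⌋; isYes≗does; dec-true; dec-false)
open import Relation.Binary.PropositionalEquality
  using (_≡_; _≢_; refl; sym; trans; cong; cong₂; subst; subst₂)

private variable
  k n m : ℕ

∧-true⁻ : ∀ {x y} → x ∧ y ≡ true → x ≡ true × y ≡ true
∧-true⁻ {true} y≡true = refl , y≡true

∧-true⁺ : ∀ {x y} → x ≡ true → y ≡ true → x ∧ y ≡ true
∧-true⁺ refl refl = refl

∧-mapˡ : ∀ {x y z} → (x ≡ true → y ≡ true) → x ∧ z ≡ true → y ∧ z ≡ true
∧-mapˡ f xz with ∧-true⁻ xz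
... | x≡true , z≡true = ∧-true⁺ (f x≡true) z≡true

⌊≟⌋-true⁺ : {x y : Fin k} → x ≡ y → ⌊ x ≟ y ⌋ ≡ true
⌊≟⌋-true⁺ {x = x} {y} x≡y = trans (isYes≗does (x ≟ y)) (dec-true (x ≟ y) x≡y)

⌊≟⌋-false⁺ : {x y : Fin k} → x ≢ y → ⌊ x ≟ y ⌋ ≡ false
⌊≟⌋-false⁺ {x = x} {y} x≢y = trans (isYes≗does (x ≟ y)) (dec-false (x ≟ y) x≢y)

⌊≟⌋-true⁻ : {x y : Fin k} → ⌊ x ≟ y ⌋ ≡ true → x ≡ y
⌊≟⌋-true⁻ {x = x} {y} _ with x ≟ y
... | yes x≡y = x≡y

not⌊≟⌋-true⁻ : {x y : Fin k} → not ⌊ x ≟ y ⌋ ≡ true → x ≢ y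
not⌊≟⌋-true⁻ {x = x} {y} _ with x ≟ y
... | no x≢y = x≢y

private variable
  c c′ d d′ e e′ : ℕ²

infixl 30 _+²_ _∸²_
infix 4 _≺_

_+²_ : ℕ² → ℕ² → ℕ²
d +² e = (proj₁ d + proj₁ e , proj₂ d + proj₂ e)

_∸²_ : ℕ² → ℕ² → ℕ²
d ∸² e = (proj₁ d ∸ proj₁ e , proj₂ d ∸ proj₂ e)

-- The witness condition of StrictlyDegenerate G f at x is, definitionally, deg G x ≺ f x.
_≺_ : ℕ² → ℕ² → Set
d ≺ e = (proj₁ d < proj₁ e) ⊎ (proj₂ d < proj₂ e)

≤²-trans : d ≤² d′ → d′ ≤² e → d ≤² e
≤²-trans (le₁ , le₂) (le₁′ , le₂′) = ≤-trans le₁ le₁′ , ≤-trans le₂ le₂′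

+²-monoˡ-≤² : ∀ d → c ≤² c′ → c +² d ≤² c′ +² d
+²-monoˡ-≤² d (le₁ , le₂) = +-monoˡ-≤ (proj₁ d) le₁ , +-monoˡ-≤ (proj₂ d) le₂

+²-cancelˡ-≤² : ∀ c → c +² d ≤² c +² e → d ≤² e
+²-cancelˡ-≤² c (le₁ , le₂) = +-cancelˡ-≤ (proj₁ c) _ _ le₁ , +-cancelˡ-≤ (proj₂ c) _ _ le₂

∸²-monoʳ-≤² : ∀ d → c ≤² c′ → d ∸² c′ ≤² d ∸² c
∸²-monoʳ-≤² d (le₁ , le₂) = ∸-monoʳ-≤ (proj₁ d) le₁ , ∸-monoʳ-≤ (proj₂ d) le₂

≤²-≺-trans : d ≤² d′ → d′ ≺ e → d ≺ e
≤²-≺-trans (le₁ , _) (inj₁ lt) = inj₁ (≤-<-trans le₁ lt)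
≤²-≺-trans (_ , le₂) (inj₂ lt) = inj₂ (≤-<-trans le₂ lt)

≺-≤²-trans : d ≺ e → e ≤² e′ → d ≺ e′
≺-≤²-trans (inj₁ lt) (le₁ , _) = inj₁ (≤-trans lt le₁)
≺-≤²-trans (inj₂ lt) (_ , le₂) = inj₂ (≤-trans lt le₂)

m<o∸n⇒n+m<o : ∀ {m} n {o} → m < o ∸ n → n + m < o
m<o∸n⇒n+m<o zero            lt = lt
m<o∸n⇒n+m<o (suc n) {suc o} lt = s≤s (m<o∸n⇒n+m<o n lt)

+²-≺ : d ≺ e ∸² c → c +² d ≺ e
+²-≺ {c = c} (inj₁ lt) = inj₁ (m<o∸n⇒n+m<o (proj₁ c) lt)
+²-≺ {c = c} (inj₂ lt) = inj₂ (m<o∸n⇒n+m<o (proj₂ c) lt)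

0≺ : e ≢ (0 , 0) → (0 , 0) ≺ e
0≺ {suc _ , _}    _   = inj₁ (s≤s z≤n)
0≺ {zero , suc _} _   = inj₂ (s≤s z≤n)
0≺ {zero , zero}  e≢0 = ⊥-elim (e≢0 refl)

count-cong : {P Q : Fin k → Bool} → (∀ x → P x ≡ Q x) → count P ≡ count Q
count-cong {zero}  P≗Q = refl
count-cong {suc k} P≗Q =
  cong₂ _+_ (cong (λ b → if b then 1 else 0) (P≗Q zero)) (count-cong (P≗Q ∘ suc))

count-zero : {P : Fin k → Bool} → (∀ x → P x ≡ false) → count P ≡ 0
count-zero {zero}      P≗false = refl
count-zero {suc k} {P} P≗false rewrite P≗false zero = count-zero (P≗false ∘ suc)

count-single : {P : Fin k → Bool} (z : Fin k) → (∀ x → x ≢ z → P x ≡ false) →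
               count P ≡ (if P z then 1 else 0)
count-single {suc k} {P} zero others =
  trans (cong ((if P zero then 1 else 0) +_) (count-zero (λ i → others (suc i) λ ())))
        (+-identityʳ _)
count-single {suc k} {P} (suc z) others rewrite others zero λ () =
  count-single z (λ i i≢z → others (suc i) (i≢z ∘ suc-injective))

count-partition : (P Q : Fin k → Bool) →
                  count P ≡ count (λ x → P x ∧ Q x) + count (λ x → P x ∧ not (Q x))
count-partition {zero}  P Q = refl
count-partition {suc k} P Q with P zero | Q zero | count-partition (P ∘ suc) (Q ∘ suc)
... | true  | true  | ih = cong suc ih
... | true  | false | ih = trans (cong suc ih) (sym (+-suc _ _))
... | false | _     | ih = ih

count-split : (P : Fin k → Bool) (z : Fin k) →
              count P ≡ (if P z then 1 else 0) + count (λ x → P x ∧ not ⌊ x ≟ z ⌋)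
count-split P z =
  trans (count-partition P (λ x → ⌊ x ≟ z ⌋))
        (cong (_+ count (λ x → P x ∧ not ⌊ x ≟ z ⌋))
              (trans (count-single z off-z) (cong (λ b → if b then 1 else 0) at-z)))
  where
  off-z : ∀ x → x ≢ z → P x ∧ ⌊ x ≟ z ⌋ ≡ false
  off-z x x≢z = trans (cong (P x ∧_) (⌊≟⌋-false⁺ x≢z)) (∧-zeroʳ _)
  at-z : P z ∧ ⌊ z ≟ z ⌋ ≡ P z
  at-z = trans (cong (P z ∧_) (⌊≟⌋-true⁺ refl)) (∧-identityʳ _)

count≤1 : {P : Fin k → Bool} → (∀ x y → P x ≡ true → P y ≡ true → x ≡ y) → count P ≤ 1
count≤1 {zero}      unique = z≤n
count≤1 {suc k} {P} unique with P zero in P0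
... | true  =
  ≤-reflexive (cong suc (count-zero λ i → ¬-not λ Pi → 0≢suc (unique zero (suc i) P0 Pi)))
  where
  0≢suc : ∀ {i : Fin k} → zero ≢ suc i
  0≢suc ()
... | false = count≤1 (λ x y Px Py → suc-injective (unique (suc x) (suc y) Px Py))

count≤if : {P : Fin k → Bool} (b : Bool) → (∀ x y → P x ≡ true → P y ≡ true → x ≡ y) →
           (∀ x → P x ≡ true → b ≡ true) → count P ≤ (if b then 1 else 0)
count≤if true  unique _     = count≤1 unique
count≤if false _      P⇒b = ≤-reflexive (count-zero λ x → ¬-not λ Px → not-¬ (P⇒b x Px) refl)

sumWhere-cong : {P Q : Fin k → Bool} (g : Fin k → ℕ) → (∀ x → P x ≡ Q x) →
                sumWhere P g ≡ sumWhere Q g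
sumWhere-cong {zero}  g P≗Q = refl
sumWhere-cong {suc k} g P≗Q =
  cong₂ _+_ (cong (λ b → if b then g zero else 0) (P≗Q zero)) (sumWhere-cong (g ∘ suc) (P≗Q ∘ suc))

sumWhere-indicator : (P Q : Fin k → Bool) →
                     sumWhere P (λ x → if Q x then 1 else 0) ≡ count (λ x → P x ∧ Q x)
sumWhere-indicator {zero}  P Q = refl
sumWhere-indicator {suc k} P Q with P zero
... | true  = cong (_ +_) (sumWhere-indicator (P ∘ suc) (Q ∘ suc))
... | false = sumWhere-indicator (P ∘ suc) (Q ∘ suc)

sumWhere-≤-+∸ : (P : Fin k → Bool) (g h : Fin k → ℕ) →
                sumWhere P g ≤ sumWhere P h + sumWhere P (λ x → g x ∸ h x)
sumWhere-≤-+∸ {zero}  P g h = z≤n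
sumWhere-≤-+∸ {suc k} P g h with P zero | sumWhere-≤-+∸ (P ∘ suc) (g ∘ suc) (h ∘ suc)
... | true  | ih = ≤-trans (+-mono-≤ (m≤n+m∸n (g zero) (h zero)) ih)
                           (≤-reflexive (interchange (h zero) (g zero ∸ h zero) _ _))
... | false | ih = ih

arcs : Digraph n → Fin n → Fin n → ℕ²
arcs D u v = (a D u v , a D v u)

V-deleteVertex⁻ : (D : Digraph n) {u v : Fin n} →
                  V (deleteVertex D v) u ≡ true → V D u ≡ true × u ≢ v
V-deleteVertex⁻ D Vu with ∧-true⁻ Vu
... | Vu , u∉v = Vu , not⌊≟⌋-true⁻ u∉v

deg-deleteVertex : (D : Digraph n) {u v : Fin n} → u ≢ v →
                   deg D u ≡ arcs D u v +² deg (deleteVertex D v) u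
deg-deleteVertex D {u} {v} u≢v rewrite ⌊≟⌋-false⁺ u≢v =
  cong₂ _,_ (count-split (A D u) v)
            (trans (count-split (λ y → A D y u) v)
                   (cong (a D v u +_) (count-cong λ y → cong (A D y u ∧_) (sym (∧-identityʳ _)))))

arcs-mono : {G K : Digraph n} → (∀ x y → A G x y ≡ true → A K x y ≡ true) →
            ∀ x y → arcs G x y ≤² arcs K x y
arcs-mono {G = G} {K} G⊆K x y = a-mono x y , a-mono y x
  where
  a-mono : ∀ x y → a G x y ≤ a K x y
  a-mono x y with A G x y in Axy
  ... | false = z≤n
  ... | true rewrite G⊆K x y Axy = ≤-refl

-- deleteSet D S is definitionally induced D (not ∘ S), so these lemmas also cover deleteVertex.
induced-isDigraph : {G : Digraph n} (T : Fin n → Bool) → IsDigraph G → IsDigraph (induced G T)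
induced-isDigraph {G = G} T isG = record
  { loopless = λ x → cong (_∧ _) (IsDigraph.loopless isG x)
  ; arc-ends = arc-ends }
  where
  arc-ends : ∀ x y → A (induced G T) x y ≡ true →
             (V (induced G T) x ≡ true) × (V (induced G T) y ≡ true)
  arc-ends x y Axy with ∧-true⁻ Axy
  ... | Axy , Txy with IsDigraph.arc-ends isG x y Axy | ∧-true⁻ Txy
  ...   | Vx , Vy | Tx , Ty = ∧-true⁺ Vx Tx , ∧-true⁺ Vy Ty

induced-mono : {G K : Digraph n} (T : Fin n → Bool) →
               IsSubdigraph G K → IsSubdigraph (induced G T) (induced K T)
induced-mono T G⊆K = record
  { G-digraph = induced-isDigraph T (IsSubdigraph.G-digraph G⊆K)
  ; V-sub = λ x → ∧-mapˡ (IsSubdigraph.V-sub G⊆K x)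
  ; A-sub = λ x y → ∧-mapˡ (IsSubdigraph.A-sub G⊆K x y) }

isSubdigraph-trans : {G K L : Digraph n} → IsSubdigraph G K → IsSubdigraph K L → IsSubdigraph G L
isSubdigraph-trans G⊆K K⊆L = record
  { G-digraph = IsSubdigraph.G-digraph G⊆K
  ; V-sub = λ x → IsSubdigraph.V-sub K⊆L x ∘ IsSubdigraph.V-sub G⊆K x
  ; A-sub = λ x y → IsSubdigraph.A-sub K⊆L x y ∘ IsSubdigraph.A-sub G⊆K x y }

deg-sole-vertex : {G : Digraph n} {z : Fin n} → IsDigraph G → (∀ y → V G y ≡ true → y ≡ z) →
                  deg G z ≡ (0 , 0)
deg-sole-vertex {G = G} {z} isG sole =
  cong₂ _,_ (count-zero λ y → ¬-not (no-arc z y)) (count-zero λ y → ¬-not (no-arc y z))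
  where
  no-arc : ∀ x y → A G x y ≢ true
  no-arc x y Axy with sole x (proj₁ (IsDigraph.arc-ends isG x y Axy))
                    | sole y (proj₂ (IsDigraph.arc-ends isG x y Axy))
  ... | refl | refl = not-¬ Axy (IsDigraph.loopless isG z)

insert : (Fin m → Bool) → Fin m → Fin m → Bool
insert T z x = T x ∨ ⌊ x ≟ z ⌋

insert-self : (T : Fin m → Bool) (z : Fin m) → insert T z z ≡ true
insert-self T z = trans (cong (T z ∨_) (⌊≟⌋-true⁺ refl)) (∨-zeroʳ _)

insert-other : {T : Fin m → Bool} {x z : Fin m} → x ≢ z → insert T z x ≡ T x
insert-other x≢z = trans (cong (_ ∨_) (⌊≟⌋-false⁺ x≢z)) (∨-identityʳ _)

induced-insert-deleteVertex⊆ : {H : Digraph m} {S T : Fin m → Bool} (z : Fin m) → IsDigraph H →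
                               (∀ x → T x ≡ true → S x ≡ true) →
                               IsSubdigraph (deleteVertex (induced H (insert T z)) z)
                                            (induced (induced H S) T)
induced-insert-deleteVertex⊆ {H = H} {S} {T} z isH T⊆S = record
  { G-digraph = induced-isDigraph _ (induced-isDigraph _ isH)
  ; V-sub = V-sub
  ; A-sub = A-sub }
  where
  T-off-z : ∀ x → insert T z x ≡ true → not ⌊ x ≟ z ⌋ ≡ true → T x ≡ true
  T-off-z x Tx x∉z = trans (sym (insert-other {T = T} (not⌊≟⌋-true⁻ x∉z))) Tx
  V-sub : ∀ x → V (deleteVertex (induced H (insert T z)) z) x ≡ true →
          V (induced (induced H S) T) x ≡ true
  V-sub x Vx with ∧-true⁻ Vx
  ... | VTx , x∉z with ∧-true⁻ VTx
  ...   | Vx , Tx = ∧-true⁺ (∧-true⁺ Vx (T⊆S x (T-off-z x Tx x∉z))) (T-off-z x Tx x∉z)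
  A-sub : ∀ x y → A (deleteVertex (induced H (insert T z)) z) x y ≡ true →
          A (induced (induced H S) T) x y ≡ true
  A-sub x y Axy with ∧-true⁻ {A H x y ∧ (insert T z x ∧ insert T z y)} Axy
  ... | ATxy , xy∉z with ∧-true⁻ {A H x y} ATxy | ∧-true⁻ xy∉z
  ...   | Axy , Txy | x∉z , y∉z with ∧-true⁻ Txy
  ...     | Tx , Ty with T-off-z x Tx x∉z | T-off-z y Ty y∉z
  ...       | T′x | T′y = ∧-true⁺ (∧-true⁺ Axy (∧-true⁺ (T⊆S x T′x) (T⊆S y T′y))) (∧-true⁺ T′x T′y)

strictlyDegenerate-⊆ : {G K : Digraph n} {f : Fin n → ℕ²} →
                       IsSubdigraph G K → StrictlyDegenerate K f → StrictlyDegenerate G f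
strictlyDegenerate-⊆ G⊆K degenerate G″ G″⊆G = degenerate G″ (isSubdigraph-trans G″⊆G G⊆K)

strictlyDegenerate-mono : {G : Digraph n} {f g : Fin n → ℕ²} → (∀ x → f x ≤² g x) →
                          StrictlyDegenerate G f → StrictlyDegenerate G g
strictlyDegenerate-mono f≤g degenerate G″ G″⊆G nonempty with degenerate G″ G″⊆G nonempty
... | x , Vx , deficient = x , Vx , ≺-≤²-trans deficient (f≤g x)

strictlyDegenerate-deleteVertex⁻ : (K : Digraph n) (f : Fin n → ℕ²) (z : Fin n) →
                                   f z ≢ (0 , 0) →
                                   StrictlyDegenerate (deleteVertex K z) (reduceF K f z) →
                                   StrictlyDegenerate K f
strictlyDegenerate-deleteVertex⁻ K f z fz≢0 degenerate G G⊆K (w , Vw)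
  with any? (λ x → V (deleteVertex G z) x Bool.≟ true)
... | yes nonempty with degenerate (deleteVertex G z) (induced-mono _ G⊆K) nonempty
...   | y , Vy∖z , deficient with V-deleteVertex⁻ G Vy∖z
...     | Vy , y≢z = y , Vy , ≤²-≺-trans deg-bound (+²-≺ deficient)
  where
  deg-bound : deg G y ≤² arcs K y z +² deg (deleteVertex G z) y
  deg-bound = subst (_≤² arcs K y z +² deg (deleteVertex G z) y) (sym (deg-deleteVertex G y≢z))
                    (+²-monoˡ-≤² (deg (deleteVertex G z) y)
                                 (arcs-mono {G = G} {K} (IsSubdigraph.A-sub G⊆K) y z))
strictlyDegenerate-deleteVertex⁻ K f z fz≢0 degenerate G G⊆K (w , Vw)
    | no empty =
  z , Vz , subst (_≺ f z) (sym (deg-sole-vertex (IsSubdigraph.G-digraph G⊆K) sole)) (0≺ fz≢0)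
  where
  sole : ∀ y → V G y ≡ true → y ≡ z
  sole y Vy with y ≟ z
  ... | yes y≡z = y≡z
  ... | no y≢z  = ⊥-elim (empty (y , ∧-true⁺ Vy (cong not (⌊≟⌋-false⁺ y≢z))))
  Vz : V G z ≡ true
  Vz = subst (λ x → V G x ≡ true) (sole w Vw) Vw

deleteFibre : Digraph m → (Fin m → Fin n) → Fin n → Digraph m
deleteFibre H p v = deleteSet H (λ x → ⌊ p x ≟ v ⌋)

module _ {D : Digraph n} {H : Digraph m} {p : Fin m → Fin n} where

  inX-fibre : ∀ {u x} → inX H p u x ≡ true → p x ≡ u
  inX-fibre = ⌊≟⌋-true⁻ ∘ proj₂ ∘ ∧-true⁻

  inX-outside : ∀ {u x} → p x ≢ u → inX H p u x ≡ false
  inX-outside px≢u = trans (cong (V H _ ∧_) (⌊≟⌋-false⁺ px≢u)) (∧-zeroʳ _)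

  inX-deleteFibre : ∀ {u v} → u ≢ v → ∀ x → inX (deleteFibre H p v) p u x ≡ inX H p u x
  inX-deleteFibre {u} {v} u≢v x with p x ≟ u | p x ≟ v
  ... | yes px≡u | yes px≡v = ⊥-elim (u≢v (trans (sym px≡u) px≡v))
  ... | yes _    | no _     = cong (_∧ true) (∧-identityʳ _)
  ... | no _     | _        = trans (∧-zeroʳ _) (sym (∧-zeroʳ _))

  fX-deleteFibre : ∀ {u v} (g : Fin m → ℕ²) → u ≢ v → fX (deleteFibre H p v) p g u ≡ fX H p g u
  fX-deleteFibre g u≢v = cong₂ _,_ (sumWhere-cong (proj₁ ∘ g) (inX-deleteFibre u≢v))
                                   (sumWhere-cong (proj₂ ∘ g) (inX-deleteFibre u≢v))

  fibre-count≤ : ∀ u (R : Fin m → Bool) (b : Bool) →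
                 (∀ x y → R x ≡ true → R y ≡ true → p x ≡ p y → x ≡ y) →
                 (∀ x → R x ≡ true → p x ≡ u → b ≡ true) →
                 sumWhere (inX H p u) (λ x → if R x then 1 else 0) ≤ (if b then 1 else 0)
  fibre-count≤ u R b injective R⇒b =
    subst (_≤ (if b then 1 else 0)) (sym (sumWhere-indicator (inX H p u) R))
          (count≤if b unique XR⇒b)
    where
    unique : ∀ x y → inX H p u x ∧ R x ≡ true → inX H p u y ∧ R y ≡ true → x ≡ y
    unique x y XRx XRy with ∧-true⁻ XRx | ∧-true⁻ XRy
    ... | Xx , Rx | Xy , Ry = injective x y Rx Ry (trans (inX-fibre Xx) (sym (inX-fibre Xy)))
    XR⇒b : ∀ x → inX H p u x ∧ R x ≡ true → b ≡ true
    XR⇒b x XRx with ∧-true⁻ XRx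
    ... | Xx , Rx = R⇒b x Rx (inX-fibre Xx)

  transversal-insert : ∀ {T z} → V H z ≡ true →
                       Transversal (deleteVertex D (p z)) (deleteFibre H p (p z)) p T →
                       Transversal D H p (insert T z)
  transversal-insert {T} {z} Vz (T⊆V′ , T-meets) = T⊆V , meets
    where
    T-outside : ∀ {x} → T x ≡ true → p x ≢ p z
    T-outside = not⌊≟⌋-true⁻ ∘ proj₂ ∘ ∧-true⁻ ∘ T⊆V′ _
    T⊆V : ∀ x → insert T z x ≡ true → V H x ≡ true
    T⊆V x Tx with x ≟ z
    ... | yes refl = Vz
    ... | no _     = proj₁ (∧-true⁻ (T⊆V′ x (trans (sym (∨-identityʳ _)) Tx)))
    meets : ∀ u → V D u ≡ true → count (λ x → insert T z x ∧ inX H p u x) ≡ 1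
    meets u Vu with p z ≟ u
    ... | yes refl = trans (count-single z off-z) (cong (λ b → if b then 1 else 0) at-z)
      where
      off-z : ∀ x → x ≢ z → insert T z x ∧ inX H p (p z) x ≡ false
      off-z x x≢z rewrite insert-other {T = T} x≢z = ¬-not λ TXx →
        T-outside (proj₁ (∧-true⁻ {T x} TXx)) (inX-fibre (proj₂ (∧-true⁻ {T x} TXx)))
      at-z : insert T z z ∧ inX H p (p z) z ≡ true
      at-z = ∧-true⁺ (insert-self T z) (∧-true⁺ Vz (⌊≟⌋-true⁺ refl))
    ... | no pz≢u =
      trans (count-cong same) (T-meets u (∧-true⁺ Vu (cong not (⌊≟⌋-false⁺ (pz≢u ∘ sym)))))
      where
      same : ∀ x → insert T z x ∧ inX H p u x ≡ T x ∧ inX (deleteFibre H p (p z)) p u x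
      same x with x ≟ z
      ... | yes refl rewrite inX-deleteFibre (pz≢u ∘ sym) z | inX-outside {u = u} pz≢u =
        trans (∧-zeroʳ _) (sym (∧-zeroʳ _))
      ... | no _ = cong₂ _∧_ (∨-identityʳ (T x)) (sym (inX-deleteFibre (pz≢u ∘ sym) x))

  colorable-deleteFibre⁻ : ∀ {f z} → IsDigraph H → V H z ≡ true → f z ≢ (0 , 0) →
                           Colorable (deleteVertex D (p z)) (deleteFibre H p (p z)) p
                                     (reduceF H f z) →
                           Colorable D H p f
  colorable-deleteFibre⁻ {f} {z} isH Vz fz≢0 (T , transversal , degenerate) =
    insert T z , transversal-insert Vz transversal ,
    strictlyDegenerate-deleteVertex⁻ H[T+z] f z fz≢0
      (strictlyDegenerate-mono (λ x → ∸²-monoʳ-≤² (f x) (arcs-mono {G = H[T+z]} {H} arcs-⊆ x z))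
        (strictlyDegenerate-⊆ (induced-insert-deleteVertex⊆ z isH T⊆S) degenerate))
    where
    H[T+z] = induced H (insert T z)
    arcs-⊆ : ∀ x y → A H[T+z] x y ≡ true → A H x y ≡ true
    arcs-⊆ x y = proj₁ ∘ ∧-true⁻
    T⊆S : ∀ x → T x ≡ true → not ⌊ p x ≟ p z ⌋ ≡ true
    T⊆S x = proj₂ ∘ ∧-true⁻ ∘ proj₁ transversal x

  module _ (cover : IsCover D H p) where

    fibre-arcs-into≤ : ∀ u z → sumWhere (inX H p u) (λ x → a H x z) ≤ a D u (p z)
    fibre-arcs-into≤ u z = fibre-count≤ u (λ x → A H x z) (A D u (p z))
      (λ x y xz yz → IsCover.match-in cover x y z xz yz)
      (λ x xz px≡u → subst (λ w → A D w (p z) ≡ true) px≡u (IsCover.along cover x z xz))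

    fibre-arcs-from≤ : ∀ u z → sumWhere (inX H p u) (λ x → a H z x) ≤ a D (p z) u
    fibre-arcs-from≤ u z = fibre-count≤ u (λ x → A H z x) (A D (p z) u)
      (λ x y zx zy → IsCover.match-out cover z x y zx zy)
      (λ x zx px≡u → subst (λ w → A D (p z) w ≡ true) px≡u (IsCover.along cover z x zx))

    fX-≤-arcs+reduceF : (f : Fin m → ℕ²) (u : Fin n) (z : Fin m) →
                        fX H p f u ≤² arcs D u (p z) +² fX H p (reduceF H f z) u
    fX-≤-arcs+reduceF f u z =
        ≤-trans (sumWhere-≤-+∸ X (proj₁ ∘ f) (λ x → a H x z)) (+-monoˡ-≤ _ (fibre-arcs-into≤ u z))
      , ≤-trans (sumWhere-≤-+∸ X (proj₂ ∘ f) (λ x → a H z x)) (+-monoˡ-≤ _ (fibre-arcs-from≤ u z))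
      where X = inX H p u

    degreeFeasible-deleteFibre : (f : Fin m → ℕ²) (z : Fin m) → DegreeFeasible D H p f →
                                 DegreeFeasible (deleteVertex D (p z)) (deleteFibre H p (p z)) p
                                                (reduceF H f z)
    degreeFeasible-deleteFibre f z feasible u Vu∖v with V-deleteVertex⁻ D Vu∖v
    ... | Vu , u≢v =
      +²-cancelˡ-≤² (arcs D u (p z))
        (subst₂ _≤²_ (deg-deleteVertex D u≢v)
                     (cong (arcs D u (p z) +²_) (sym (fX-deleteFibre (reduceF H f z) u≢v)))
                     (≤²-trans (feasible u Vu) (fX-≤-arcs+reduceF f u z)))

proposition19 : ∀ {n m} (D : Digraph n) (H : Digraph m) (p : Fin m → Fin n) (f : Fin m → ℕ²) →
    IsDigraph D → IsDigraph H → IsCover D H p →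
    Connected D →
    (v : Fin n) → V D v ≡ true → ¬ IsSeparating D v →
    (xv : Fin m) → V H xv ≡ true → p xv ≡ v → f xv ≢ (0 , 0) →
    (DegreeFeasible D H p f →
       DegreeFeasible (deleteVertex D v) (deleteSet H (λ x → ⌊ p x ≟ v ⌋)) p (reduceF H f xv))
    × (Uncolorable D H p f →
       Uncolorable (deleteVertex D v) (deleteSet H (λ x → ⌊ p x ≟ v ⌋)) p (reduceF H f xv))
proposition19 D H p f _ isH cover _ _ _ _ xv Vxv refl fxv≢0 =
    degreeFeasible-deleteFibre cover f xv
  , λ uncolorable → uncolorable ∘ colorable-deleteFibre⁻ {D = D} isH Vxv fxv≢0
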